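{- Let $G$ and $H$ be finite simple graphs with ${\rm diam}(G)=3$ and $H$ not edgeless (i.e. $H\not\cong\overline{K}_n$ for every $n$). Then $$\chi_{\rho}(G\circ H)=|G|\cdot|H|-\alpha(G)\alpha(H)-\rho_2(G)+2.$$
   Context: $|G|$ denotes the number of vertices, ${\rm diam}(G)$ the diameter and $\alpha(G)$ the independence number. $\rho_2(G)$ is the maximum size of a set of vertices of $G$ any two distinct members of which are at distance more than $2$. A $k$-packing coloring of a graph is a map $c:V\to\{1,\dots,k\}$ such that two distinct vertices with $c(u)=c(v)=i$ are at distance more than $i$; the packing chromatic number $\chi_\rho$ is the least such $k$. The lexicographic product $G\circ H$ has vertex set $V(G)\times V(H)$, with $(g_1,h_1)\sim(g_2,h_2)$ iff $g_1g_2\in E(G)$, or $g_1=g_2$ and $h_1h_2\in E(H)$. $\overline{K}_n$ is the edgeless graph on $n$ vertices. -}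

module Defs where

open import Data.Nat using (ℕ; zero; suc; _≤_; _*_)
open import Data.Bool using (Bool; true; false; _∨_; _∧_)
open import Data.Fin using (Fin; toℕ; remQuot; _≟_)
open import Data.Fin.Subset using (Subset; _∈_; ∣_∣)
open import Data.Product using (Σ; _×_; _,_; ∃; proj₁; proj₂)
open import Relation.Nullary using (¬_; does)
open import Relation.Binary.PropositionalEquality using (_≡_; _≢_)

record Graph : Set where
  field
    size : ℕ
    adj  : Fin size → Fin size → Bool
open Graph public

IsSimple : Graph → Set
IsSimple G = (∀ u → adj G u u ≡ false) × (∀ u v → adj G u v ≡ adj G v u)

data Walk (G : Graph) : ℕ → Fin (size G) → Fin (size G) → Set where
  here : ∀ {u} → Walk G zero u u
  step : ∀ {k u w v} → adj G u w ≡ true → Walk G k w v → Walk G (suc k) u v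

DistLe : (G : Graph) → ℕ → Fin (size G) → Fin (size G) → Set
DistLe G k u v = Σ ℕ λ j → j ≤ k × Walk G j u v

Diam3 : Graph → Set
Diam3 G = (∀ u v → DistLe G 3 u v) × (Σ (Fin (size G)) λ u → Σ (Fin (size G)) λ v → ¬ DistLe G 2 u v)

HasEdge : Graph → Set
HasEdge G = Σ (Fin (size G)) λ u → Σ (Fin (size G)) λ v → adj G u v ≡ true

Independent : (G : Graph) → Subset (size G) → Set
Independent G S = ∀ u v → u ∈ S → v ∈ S → u ≢ v → adj G u v ≡ false

IsIndepNumber : Graph → ℕ → Set
IsIndepNumber G a =
  (Σ (Subset (size G)) λ S → Independent G S × ∣ S ∣ ≡ a) ×
  (∀ S → Independent G S → ∣ S ∣ ≤ a)

Packing2 : (G : Graph) → Subset (size G) → Set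
Packing2 G S = ∀ u v → u ∈ S → v ∈ S → u ≢ v → ¬ DistLe G 2 u v

IsRho2 : Graph → ℕ → Set
IsRho2 G r =
  (Σ (Subset (size G)) λ S → Packing2 G S × ∣ S ∣ ≡ r) ×
  (∀ S → Packing2 G S → ∣ S ∣ ≤ r)

-- k-packing coloring; colour c u : Fin k stands for the colour toℕ (c u) + 1.
IsPackingColoring : (G : Graph) (k : ℕ) → (Fin (size G) → Fin k) → Set
IsPackingColoring G k c =
  ∀ u v → u ≢ v → c u ≡ c v → ¬ DistLe G (suc (toℕ (c u))) u v

IsPackingChromaticNumber : Graph → ℕ → Set
IsPackingChromaticNumber G k =
  (Σ (Fin (size G) → Fin k) λ c → IsPackingColoring G k c) ×
  (∀ m (c : Fin (size G) → Fin m) → IsPackingColoring G m c → k ≤ m)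

-- Lexicographic product G ∘ H on Fin (|G| * |H|), vertex x ↔ remQuot x = (g , h).
lex : Graph → Graph → Graph
lex G H = record
  { size = size G * size H
  ; adj  = λ x y →
      let gx = proj₁ (remQuot {size G} (size H) x) ; hx = proj₂ (remQuot {size G} (size H) x)
          gy = proj₁ (remQuot {size G} (size H) y) ; hy = proj₂ (remQuot {size G} (size H) y)
      in adj G gx gy ∨ (does (gx ≟ gy) ∧ adj H hx hy)
  }

-- Lower bound: in a packing colouring of G ∘ H, the class of colour 1 is independent, so it has
-- at most α(G) α(H) vertices (its projection to G is independent in G, and every G-fibre of it is
-- independent in H); the class of colour 2 is a 2-packing, so it has at most ρ₂(G) vertices (two
-- vertices in one G-fibre are at distance 2 through a neighbour in G, so each fibre holds at most one
-- of them, and the projection is a 2-packing of G); and G ∘ H has diameter 3, so every other class is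
-- a singleton.  Upper bound: take maximum independent sets I of G and J of H, a maximum 2-packing P
-- of G and a vertex h₀ ∉ J (J cannot contain both ends of an edge of H); colour I × J with 1,
-- P × {h₀} with 2, and every remaining vertex with its own colour.
module Submission where

open import Data.Bool using (Bool; true; false; not; _∧_; _∨_)
open import Data.Bool.Properties using (¬-not; not-¬)
open import Data.Fin using (Fin; zero; suc; toℕ; combine; remQuot; _↑ˡ_; _↑ʳ_)
open import Data.Fin.Properties
  using (_≟_; suc-injective; remQuot-combine; combine-remQuot; combine-injectiveˡ; combine-injectiveʳ)
open import Data.Fin.Subset using (Subset; _∈_; _∉_; ∣_∣; ⁅_⁆)
open import Data.Fin.Subset.Properties
  using (_∈?_; nonempty?; Empty-unique; ∣⊥∣≡0; ∣⁅x⁆∣≡1; x∈⁅x⁆; x∈⁅y⁆⇒x≡y; p⊆q⇒∣p∣≤∣q∣)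
open import Data.Nat using (ℕ; zero; suc; _+_; _*_; _≤_; z≤n; s≤s)
open import Data.Nat.Properties
  using ( +-*-semiring; ≤-refl; ≤-trans; ≤-reflexive; ≤-antisym; +-mono-≤; +-monoˡ-≤; *-monoʳ-≤
        ; +-identityʳ; *-identityˡ; *-identityʳ; *-zeroʳ; *-comm; +-assoc; n≤1+n; module ≤-Reasoning)
open import Algebra.Properties.Semiring.Sum +-*-semiring
  using (sum; sum-syntax; sum-cong-≗; ∑-distrib-+; ∑-comm; *-distribˡ-sum; *-distribʳ-sum)
open import Data.Nat.Tactic.RingSolver using (solve-∀)
open import Data.Product using (_×_; _,_; ∃; proj₁; proj₂)
open import Data.Sum using (_⊎_; inj₁; inj₂; [_,_])
open import Data.Vec using ([]; _∷_; tabulate; here; there)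
open import Data.Vec.Properties using (lookup∘tabulate; []=⇒lookup; lookup⇒[]=)
open import Function using (_∘_)
open import Level using (Level)
open import Relation.Binary.PropositionalEquality
  using (_≡_; _≢_; refl; sym; trans; cong; cong₂; subst; subst₂; module ≡-Reasoning)
open import Relation.Nullary using (¬_; does; yes; no; contradiction; _×-dec_; _⊎-dec_; ¬?)
open import Relation.Nullary.Decidable using (dec-true; decidable-stable)
open import Relation.Unary using (Pred; Decidable)

open import Defs

private
  variable
    m n : ℕ
    ℓ : Level

𝟙 : Bool → ℕ
𝟙 true = 1
𝟙 false = 0

𝟙-∧ : ∀ a b → 𝟙 (a ∧ b) ≡ 𝟙 a * 𝟙 b
𝟙-∧ true b = sym (+-identityʳ (𝟙 b))
𝟙-∧ false b = refl

∑-mono-≤ : {f g : Fin n → ℕ} → (∀ i → f i ≤ g i) → sum f ≤ sum g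
∑-mono-≤ {zero} f≤g = z≤n
∑-mono-≤ {suc n} f≤g = +-mono-≤ (f≤g zero) (∑-mono-≤ (f≤g ∘ suc))

∑-const : ∀ n c → ∑[ i < n ] c ≡ n * c
∑-const zero c = refl
∑-const (suc n) c = cong (c +_) (∑-const n c)

∑-split : ∀ m {n} (f : Fin (m + n) → ℕ) → sum f ≡ ∑[ i < m ] f (i ↑ˡ n) + ∑[ j < n ] f (m ↑ʳ j)
∑-split zero f = refl
∑-split (suc m) f = trans (cong (f zero +_) (∑-split m (f ∘ suc))) (sym (+-assoc (f zero) _ _))

∑-combine : ∀ m {n} (f : Fin (m * n) → ℕ) → sum f ≡ ∑[ g < m ] ∑[ h < n ] f (combine g h)
∑-combine zero f = refl
∑-combine (suc m) {n} f =
  trans (∑-split n f) (cong (∑[ h < n ] f (combine {suc m} zero h) +_) (∑-combine m {n} (f ∘ (n ↑ʳ_))))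

∑-𝟙-≟ : (j : Fin n) → ∑[ i < n ] 𝟙 (does (j ≟ i)) ≡ 1
∑-𝟙-≟ {suc n} zero = cong suc (trans (∑-const n 0) (*-zeroʳ n))
∑-𝟙-≟ (suc j) = ∑-𝟙-≟ j

subset : {P : Pred (Fin n) ℓ} → Decidable P → Subset n
subset P? = tabulate (does ∘ P?)

module _ {P : Pred (Fin n) ℓ} (P? : Decidable P) where

  ∈-subset⁺ : ∀ {x} → P x → x ∈ subset P?
  ∈-subset⁺ {x} px = lookup⇒[]= x _ (trans (lookup∘tabulate (does ∘ P?) x) (dec-true (P? x) px))

  ∈-subset⁻ : ∀ {x} → x ∈ subset P? → P x
  ∈-subset⁻ {x} x∈ with P? x | trans (sym (lookup∘tabulate (does ∘ P?) x)) ([]=⇒lookup x∈)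
  ... | yes px | _ = px
  ... | no _ | ()

∣tabulate∣ : (p : Fin n → Bool) → ∣ tabulate p ∣ ≡ ∑[ x < n ] 𝟙 (p x)
∣tabulate∣ {zero} p = refl
∣tabulate∣ {suc n} p with p zero
... | true = cong suc (∣tabulate∣ (p ∘ suc))
... | false = ∣tabulate∣ (p ∘ suc)

∣subset∣ : {P : Pred (Fin n) ℓ} (P? : Decidable P) → ∣ subset P? ∣ ≡ ∑[ x < n ] 𝟙 (does (P? x))
∣subset∣ P? = ∣tabulate∣ (does ∘ P?)

∣∣≡∑ : (S : Subset n) → ∣ S ∣ ≡ ∑[ x < n ] 𝟙 (does (x ∈? S))
∣∣≡∑ [] = refl
∣∣≡∑ (true ∷ S) = cong suc (∣∣≡∑ S)
∣∣≡∑ (false ∷ S) = ∣∣≡∑ S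

∣∣≤1 : {S : Subset n} → (∀ {x y} → x ∈ S → y ∈ S → x ≡ y) → ∣ S ∣ ≤ 1
∣∣≤1 {n} {S} unique with nonempty? S
... | yes (x , x∈S) =
  ≤-trans (p⊆q⇒∣p∣≤∣q∣ (λ y∈S → subst (_∈ ⁅ x ⁆) (unique x∈S y∈S) (x∈⁅x⁆ x))) (≤-reflexive (∣⁅x⁆∣≡1 x))
... | no empty = ≤-trans (≤-reflexive (trans (cong ∣_∣ (Empty-unique empty)) (∣⊥∣≡0 n))) z≤n

rank : {S : Subset n} {x : Fin n} → x ∈ S → Fin ∣ S ∣
rank {S = true ∷ S} here = zero
rank {S = true ∷ S} (there x∈S) = suc (rank x∈S)
rank {S = false ∷ S} (there x∈S) = rank x∈S

rank-injective : {S : Subset n} {x y : Fin n} (x∈S : x ∈ S) (y∈S : y ∈ S) → rank x∈S ≡ rank y∈S → x ≡ y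
rank-injective {S = true ∷ S} here here _ = refl
rank-injective {S = true ∷ S} (there x∈S) (there y∈S) eq =
  cong suc (rank-injective x∈S y∈S (suc-injective eq))
rank-injective {S = false ∷ S} (there x∈S) (there y∈S) eq = cong suc (rank-injective x∈S y∈S eq)

uncovered : Subset n → Subset n → Subset n
uncovered A B = subset (λ x → ¬? ((x ∈? A) ⊎-dec (x ∈? B)))

∈-uncovered⁺ : ∀ {A B : Subset n} {x} → x ∉ A → x ∉ B → x ∈ uncovered A B
∈-uncovered⁺ {A = A} {B} x∉A x∉B = ∈-subset⁺ (λ x → ¬? ((x ∈? A) ⊎-dec (x ∈? B))) [ x∉A , x∉B ]

∣∣+∣∣+∣uncovered∣ : ∀ {A B : Subset n} → (∀ {x} → x ∈ A → x ∉ B) → ∣ A ∣ + ∣ B ∣ + ∣ uncovered A B ∣ ≡ n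
∣∣+∣∣+∣uncovered∣ {n} {A} {B} disjoint = begin
  ∣ A ∣ + ∣ B ∣ + ∣ uncovered A B ∣
    ≡⟨ cong₂ _+_ (cong₂ _+_ (∣∣≡∑ A) (∣∣≡∑ B)) (∣subset∣ (λ x → ¬? ((x ∈? A) ⊎-dec (x ∈? B)))) ⟩
  ∑[ x < n ] 𝟙 (a x) + ∑[ x < n ] 𝟙 (b x) + ∑[ x < n ] 𝟙 (not (a x ∨ b x))
    ≡⟨ cong (_+ ∑[ x < n ] 𝟙 (not (a x ∨ b x))) (∑-distrib-+ (𝟙 ∘ a) (𝟙 ∘ b)) ⟨
  ∑[ x < n ] (𝟙 (a x) + 𝟙 (b x)) + ∑[ x < n ] 𝟙 (not (a x ∨ b x))
    ≡⟨ ∑-distrib-+ (λ x → 𝟙 (a x) + 𝟙 (b x)) (λ x → 𝟙 (not (a x ∨ b x))) ⟨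
  ∑[ x < n ] (𝟙 (a x) + 𝟙 (b x) + 𝟙 (not (a x ∨ b x)))
    ≡⟨ sum-cong-≗ exactly-one ⟩
  ∑[ x < n ] 1
    ≡⟨ trans (∑-const n 1) (*-identityʳ n) ⟩
  n ∎
  where
  open ≡-Reasoning
  a b : Fin n → Bool
  a x = does (x ∈? A)
  b x = does (x ∈? B)
  exactly-one : ∀ x → 𝟙 (a x) + 𝟙 (b x) + 𝟙 (not (a x ∨ b x)) ≡ 1
  exactly-one x with x ∈? A | x ∈? B
  ... | yes x∈A | yes x∈B = contradiction x∈B (disjoint x∈A)
  ... | yes _ | no _ = refl
  ... | no _ | yes _ = refl
  ... | no _ | no _ = refl

Loopless : Graph → Set
Loopless Γ = ∀ u → adj Γ u u ≡ false

module _ {Γ : Graph} where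

  Walk-0⇒≡ : ∀ {u v} → Walk Γ 0 u v → u ≡ v
  Walk-0⇒≡ here = refl

  DistLe-refl : ∀ {k} u → DistLe Γ k u u
  DistLe-refl u = 0 , z≤n , here

  DistLe-mono : ∀ {j k u v} → j ≤ k → DistLe Γ j u v → DistLe Γ k u v
  DistLe-mono j≤k (i , i≤j , w) = i , ≤-trans i≤j j≤k , w

  adj⇒DistLe : ∀ {k u v} → adj Γ u v ≡ true → DistLe Γ (suc k) u v
  adj⇒DistLe e = 1 , s≤s z≤n , step e here

  DistLe-1⇒adj : ∀ {u v} → u ≢ v → DistLe Γ 1 u v → adj Γ u v ≡ true
  DistLe-1⇒adj u≢v (zero , _ , w) = contradiction (Walk-0⇒≡ w) u≢v
  DistLe-1⇒adj u≢v (suc zero , _ , step e here) = e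
  DistLe-1⇒adj u≢v (suc (suc _) , s≤s () , _)

  independent-sparse : ∀ {S x y} → Independent Γ S → x ∈ S → y ∈ S → x ≢ y → ¬ DistLe Γ 1 x y
  independent-sparse indep x∈ y∈ x≢y d = not-¬ (indep _ _ x∈ y∈ x≢y) (DistLe-1⇒adj x≢y d)

  sparse-independent : ∀ {S} → (∀ {x y} → x ∈ S → y ∈ S → x ≢ y → ¬ DistLe Γ 1 x y) → Independent Γ S
  sparse-independent sparse x y x∈ y∈ x≢y = ¬-not λ e → sparse x∈ y∈ x≢y (adj⇒DistLe e)

  adj⇒≢ : Loopless Γ → ∀ {u v} → adj Γ u v ≡ true → u ≢ v
  adj⇒≢ loopless {u} e refl = not-¬ (loopless u) e

  neighbour : ∀ {d u v} → (∀ x y → DistLe Γ d x y) → u ≢ v → ∃ λ w → adj Γ u w ≡ true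
  neighbour {u = u} {v} connected u≢v with connected u v
  ... | zero , _ , w = contradiction (Walk-0⇒≡ w) u≢v
  ... | suc _ , _ , step e _ = _ , e

  diam3⇒neighbour : Diam3 Γ → ∀ g → ∃ λ w → adj Γ g w ≡ true
  diam3⇒neighbour (connected , u , v , far) g with g ≟ u
  ... | no g≢u = neighbour connected g≢u
  ... | yes refl = neighbour {v = v} connected λ { refl → far (DistLe-refl u) }

  independent-omits : Loopless Γ → HasEdge Γ → ∀ {S} → Independent Γ S → ∃ λ w → w ∉ S
  independent-omits loopless (u , v , e) {S} indep with u ∈? S | v ∈? S
  ... | no u∉S | _ = u , u∉S
  ... | yes _ | no v∉S = v , v∉S
  ... | yes u∈S | yes v∈S = contradiction e (not-¬ (indep u v u∈S v∈S (adj⇒≢ loopless e)))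

  colourClass : ∀ {k} → (Fin (size Γ) → Fin k) → Fin k → Subset (size Γ)
  colourClass c i = subset (λ x → c x ≟ i)

  ∈-colourClass⁻ : ∀ {k} {c : Fin (size Γ) → Fin k} {i x} → x ∈ colourClass c i → c x ≡ i
  ∈-colourClass⁻ {c = c} {i} = ∈-subset⁻ (λ x → c x ≟ i)

  ∑-∣colourClass∣ : ∀ {k} (c : Fin (size Γ) → Fin k) → ∑[ i < k ] ∣ colourClass c i ∣ ≡ size Γ
  ∑-∣colourClass∣ {k} c = begin
    ∑[ i < k ] ∣ colourClass c i ∣                      ≡⟨ sum-cong-≗ (λ i → ∣subset∣ (λ x → c x ≟ i)) ⟩
    ∑[ i < k ] ∑[ x < size Γ ] 𝟙 (does (c x ≟ i))       ≡⟨ ∑-comm (λ i x → 𝟙 (does (c x ≟ i))) ⟩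
    ∑[ x < size Γ ] ∑[ i < k ] 𝟙 (does (c x ≟ i))       ≡⟨ sum-cong-≗ (λ x → ∑-𝟙-≟ (c x)) ⟩
    ∑[ x < size Γ ] 1                                   ≡⟨ ∑-const (size Γ) 1 ⟩
    size Γ * 1                                          ≡⟨ *-identityʳ (size Γ) ⟩
    size Γ                                              ∎
    where open ≡-Reasoning

  module _ {k} {c : Fin (size Γ) → Fin k} (packing : IsPackingColoring Γ k c) where

    colourClass-sparse : ∀ {i x y} → x ∈ colourClass c i → y ∈ colourClass c i → x ≢ y →
                         ¬ DistLe Γ (suc (toℕ i)) x y
    colourClass-sparse {i} {x} {y} x∈ y∈ x≢y =
      subst (λ j → ¬ DistLe Γ (suc (toℕ j)) x y) cx≡i (packing x y x≢y (trans cx≡i (sym cy≡i)))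
      where
      cx≡i : c x ≡ i
      cx≡i = ∈-colourClass⁻ {c = c} x∈
      cy≡i : c y ≡ i
      cy≡i = ∈-colourClass⁻ {c = c} y∈

    adjacent-colours-differ : ∀ {u v} → adj Γ u v ≡ true → u ≢ v → c u ≢ c v
    adjacent-colours-differ e u≢v same = packing _ _ u≢v same (adj⇒DistLe e)

  packingColouring-lowerBound :
    ∀ {a r k} {c : Fin (size Γ) → Fin k} → Loopless Γ → HasEdge Γ →
    (∀ S → Independent Γ S → ∣ S ∣ ≤ a) → (∀ S → Packing2 Γ S → ∣ S ∣ ≤ r) →
    (∀ x y → DistLe Γ 3 x y) → IsPackingColoring Γ k c →
    size Γ + 2 ≤ k + a + r
  packingColouring-lowerBound {k = zero} {c} _ (u , _) _ _ _ _ with c u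
  ... | ()
  packingColouring-lowerBound {k = 1} {c} loopless (u , v , e) _ _ _ packing with c u in cu | c v in cv
  ... | zero | zero = contradiction (trans cu (sym cv)) (adjacent-colours-differ packing e (adj⇒≢ loopless e))
  packingColouring-lowerBound {a} {r} {suc (suc k)} {c} _ _ α-bound ρ₂-bound diam≤3 packing =
    ≤-trans (+-monoˡ-≤ 2 classes-bound) (≤-reflexive (rearrange a r k))
    where
    rearrange : ∀ a r k → a + (r + k * 1) + 2 ≡ suc (suc k) + a + r
    rearrange = solve-∀

    bound : Fin (suc (suc k)) → ℕ
    bound zero = a
    bound (suc zero) = r
    bound (suc (suc _)) = 1

    class-bound : ∀ i → ∣ colourClass c i ∣ ≤ bound i
    class-bound zero = α-bound _ (sparse-independent λ x∈ y∈ x≢y → colourClass-sparse packing x∈ y∈ x≢y)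
    class-bound (suc zero) = ρ₂-bound _ λ x y x∈ y∈ x≢y → colourClass-sparse packing x∈ y∈ x≢y
    class-bound (suc (suc i)) = ∣∣≤1 λ {x} {y} x∈ y∈ → decidable-stable (x ≟ y) λ x≢y →
      colourClass-sparse packing x∈ y∈ x≢y (DistLe-mono (s≤s (s≤s (s≤s z≤n))) (diam≤3 x y))

    classes-bound : size Γ ≤ a + (r + k * 1)
    classes-bound = begin
      size Γ                                   ≡⟨ sym (∑-∣colourClass∣ c) ⟩
      ∑[ i < suc (suc k) ] ∣ colourClass c i ∣ ≤⟨ ∑-mono-≤ class-bound ⟩
      a + (r + ∑[ i < k ] 1)                   ≡⟨ cong (λ t → a + (r + t)) (∑-const k 1) ⟩
      a + (r + k * 1)                          ∎
      where open ≤-Reasoning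

  module TwoClassColouring (A B : Subset (size Γ)) where

    data Region (x : Fin (size Γ)) : Set where
      inA : x ∈ A → Region x
      inB : x ∈ B → Region x
      elsewhere : x ∈ uncovered A B → Region x

    region : ∀ x → Region x
    region x with x ∈? A | x ∈? B
    ... | yes x∈A | _ = inA x∈A
    ... | no _ | yes x∈B = inB x∈B
    ... | no x∉A | no x∉B = elsewhere (∈-uncovered⁺ x∉A x∉B)

    colourOf : ∀ {x} → Region x → Fin (2 + ∣ uncovered A B ∣)
    colourOf (inA _) = zero
    colourOf (inB _) = suc zero
    colourOf (elsewhere x∈U) = suc (suc (rank x∈U))

    colour : Fin (size Γ) → Fin (2 + ∣ uncovered A B ∣)
    colour x = colourOf (region x)

    colour-packing : Independent Γ A → Packing2 Γ B → IsPackingColoring Γ (2 + ∣ uncovered A B ∣) colour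
    colour-packing indep packing x y x≢y same with region x | region y
    colour-packing indep packing x y x≢y same | inA x∈A | inA y∈A = independent-sparse indep x∈A y∈A x≢y
    colour-packing indep packing x y x≢y same | inB x∈B | inB y∈B = packing x y x∈B y∈B x≢y
    colour-packing indep packing x y x≢y same | elsewhere x∈U | elsewhere y∈U =
      contradiction (rank-injective x∈U y∈U (suc-injective (suc-injective same))) x≢y
    colour-packing indep packing x y x≢y () | inA _ | inB _
    colour-packing indep packing x y x≢y () | inA _ | elsewhere _
    colour-packing indep packing x y x≢y () | inB _ | inA _
    colour-packing indep packing x y x≢y () | inB _ | elsewhere _
    colour-packing indep packing x y x≢y () | elsewhere _ | inA _
    colour-packing indep packing x y x≢y () | elsewhere _ | inB _

  packingColouring-upperBound :
    ∀ {k A B} → (∀ m (c : Fin (size Γ) → Fin m) → IsPackingColoring Γ m c → k ≤ m) →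
    Independent Γ A → Packing2 Γ B → (∀ {x} → x ∈ A → x ∉ B) → k + ∣ A ∣ + ∣ B ∣ ≤ size Γ + 2
  packingColouring-upperBound {k} {A} {B} minimal indep packing disjoint = begin
    k + ∣ A ∣ + ∣ B ∣
      ≤⟨ +-monoˡ-≤ (∣ B ∣) (+-monoˡ-≤ (∣ A ∣) (minimal _ colour (colour-packing indep packing))) ⟩
    2 + ∣ uncovered A B ∣ + ∣ A ∣ + ∣ B ∣
      ≡⟨ rearrange (∣ uncovered A B ∣) (∣ A ∣) (∣ B ∣) ⟩
    ∣ A ∣ + ∣ B ∣ + ∣ uncovered A B ∣ + 2
      ≡⟨ cong (_+ 2) (∣∣+∣∣+∣uncovered∣ disjoint) ⟩
    size Γ + 2 ∎
    where
    open TwoClassColouring A B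
    open ≤-Reasoning
    rearrange : ∀ u a b → 2 + u + a + b ≡ a + b + u + 2
    rearrange = solve-∀

module Grid (m n : ℕ) where

  π₁ : Fin (m * n) → Fin m
  π₁ x = proj₁ (remQuot {m} n x)

  π₂ : Fin (m * n) → Fin n
  π₂ x = proj₂ (remQuot {m} n x)

  π₁-combine : ∀ g h → π₁ (combine g h) ≡ g
  π₁-combine g h = cong proj₁ (remQuot-combine {m} {n} g h)

  π₂-combine : ∀ g h → π₂ (combine g h) ≡ h
  π₂-combine g h = cong proj₂ (remQuot-combine {m} {n} g h)

  π-injective : ∀ {x y} → π₁ x ≡ π₁ y → π₂ x ≡ π₂ y → x ≡ y
  π-injective {x} {y} eq₁ eq₂ = begin
    x                     ≡⟨ combine-remQuot {m} n x ⟨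
    combine (π₁ x) (π₂ x) ≡⟨ cong₂ combine eq₁ eq₂ ⟩
    combine (π₁ y) (π₂ y) ≡⟨ combine-remQuot {m} n y ⟩
    y                     ∎
    where open ≡-Reasoning

  fibre : Subset (m * n) → Fin m → Subset n
  fibre S g = subset (λ h → combine g h ∈? S)

  ∈-fibre⁻ : ∀ {S g h} → h ∈ fibre S g → combine g h ∈ S
  ∈-fibre⁻ {S} {g} = ∈-subset⁻ (λ h → combine g h ∈? S)

  shadow : Subset (m * n) → Subset m
  shadow S = subset (λ g → nonempty? (fibre S g))

  ∈-shadow⁻ : ∀ {S g} → g ∈ shadow S → ∃ λ h → combine g h ∈ S
  ∈-shadow⁻ {S} g∈ with ∈-subset⁻ (λ g → nonempty? (fibre S g)) g∈
  ... | h , h∈ = h , ∈-fibre⁻ h∈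

  ∣∣≡∑∣fibre∣ : ∀ S → ∣ S ∣ ≡ ∑[ g < m ] ∣ fibre S g ∣
  ∣∣≡∑∣fibre∣ S = begin
    ∣ S ∣
      ≡⟨ ∣∣≡∑ S ⟩
    ∑[ x < m * n ] 𝟙 (does (x ∈? S))
      ≡⟨ ∑-combine m (λ x → 𝟙 (does (x ∈? S))) ⟩
    ∑[ g < m ] ∑[ h < n ] 𝟙 (does (combine g h ∈? S))
      ≡⟨ sum-cong-≗ {m} (λ g → ∣subset∣ (λ h → combine g h ∈? S)) ⟨
    ∑[ g < m ] ∣ fibre S g ∣ ∎
    where open ≡-Reasoning

  ∣∣≤*∣shadow∣ : ∀ {b} S → (∀ g → ∣ fibre S g ∣ ≤ b) → ∣ S ∣ ≤ b * ∣ shadow S ∣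
  ∣∣≤*∣shadow∣ {b} S ∣fibre∣≤b = begin
    ∣ S ∣                           ≡⟨ ∣∣≡∑∣fibre∣ S ⟩
    ∑[ g < m ] ∣ fibre S g ∣        ≤⟨ ∑-mono-≤ fibre-bound ⟩
    ∑[ g < m ] (b * 𝟙 (occupied g)) ≡⟨ *-distribˡ-sum b (𝟙 ∘ occupied) ⟨
    b * ∑[ g < m ] 𝟙 (occupied g)   ≡⟨ cong (b *_) (∣subset∣ (λ g → nonempty? (fibre S g))) ⟨
    b * ∣ shadow S ∣                ∎
    where
    open ≤-Reasoning
    occupied : Fin m → Bool
    occupied g = does (nonempty? (fibre S g))
    fibre-bound : ∀ g → ∣ fibre S g ∣ ≤ b * 𝟙 (occupied g)
    fibre-bound g with nonempty? (fibre S g)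
    ... | yes _ = ≤-trans (∣fibre∣≤b g) (≤-reflexive (sym (*-identityʳ b)))
    ... | no empty = ≤-trans (≤-reflexive (trans (cong ∣_∣ (Empty-unique empty)) (∣⊥∣≡0 n))) z≤n

  _⊗_ : Subset m → Subset n → Subset (m * n)
  A ⊗ B = subset (λ x → (π₁ x ∈? A) ×-dec (π₂ x ∈? B))

  ∈-⊗⁻ : ∀ {A B x} → x ∈ A ⊗ B → π₁ x ∈ A × π₂ x ∈ B
  ∈-⊗⁻ {A} {B} = ∈-subset⁻ (λ x → (π₁ x ∈? A) ×-dec (π₂ x ∈? B))

  ⊗⁅⁆-disjoint : ∀ {A B C h x} → h ∉ B → x ∈ A ⊗ B → x ∉ C ⊗ ⁅ h ⁆
  ⊗⁅⁆-disjoint {A} {B} {C} {h} h∉B x∈ x∈′ =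
    h∉B (subst (_∈ B) (x∈⁅y⁆⇒x≡y h (proj₂ (∈-⊗⁻ {C} x∈′))) (proj₂ (∈-⊗⁻ {A} x∈)))

  ∣⊗∣ : ∀ A B → ∣ A ⊗ B ∣ ≡ ∣ A ∣ * ∣ B ∣
  ∣⊗∣ A B = begin
    ∣ A ⊗ B ∣
      ≡⟨ ∣subset∣ (λ x → (π₁ x ∈? A) ×-dec (π₂ x ∈? B)) ⟩
    ∑[ x < m * n ] 𝟙 (a (π₁ x) ∧ b (π₂ x))
      ≡⟨ ∑-combine m (λ x → 𝟙 (a (π₁ x) ∧ b (π₂ x))) ⟩
    ∑[ g < m ] ∑[ h < n ] 𝟙 (a (π₁ (combine g h)) ∧ b (π₂ (combine g h)))
      ≡⟨ sum-cong-≗ (λ g → sum-cong-≗ λ h →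
           cong₂ (λ g′ h′ → 𝟙 (a g′ ∧ b h′)) (π₁-combine g h) (π₂-combine g h)) ⟩
    ∑[ g < m ] ∑[ h < n ] 𝟙 (a g ∧ b h)
      ≡⟨ sum-cong-≗ (λ g → sum-cong-≗ (λ h → 𝟙-∧ (a g) (b h))) ⟩
    ∑[ g < m ] ∑[ h < n ] (𝟙 (a g) * 𝟙 (b h))
      ≡⟨ sum-cong-≗ (λ g → *-distribˡ-sum (𝟙 (a g)) (𝟙 ∘ b)) ⟨
    ∑[ g < m ] (𝟙 (a g) * ∑[ h < n ] 𝟙 (b h))
      ≡⟨ *-distribʳ-sum (∑[ h < n ] 𝟙 (b h)) (𝟙 ∘ a) ⟨
    (∑[ g < m ] 𝟙 (a g)) * ∑[ h < n ] 𝟙 (b h)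
      ≡⟨ cong₂ _*_ (∣∣≡∑ A) (∣∣≡∑ B) ⟨
    ∣ A ∣ * ∣ B ∣ ∎
    where
    open ≡-Reasoning
    a : Fin m → Bool
    a g = does (g ∈? A)
    b : Fin n → Bool
    b h = does (h ∈? B)

module Lex (G H : Graph) where

  open Grid (size G) (size H) public

  private
    Γ = lex G H

  lex-adjᴳ : ∀ {x y} → adj G (π₁ x) (π₁ y) ≡ true → adj Γ x y ≡ true
  lex-adjᴳ e = cong (_∨ _) e

  lex-adjᴴ : ∀ {x y} → π₁ x ≡ π₁ y → adj H (π₂ x) (π₂ y) ≡ true → adj Γ x y ≡ true
  lex-adjᴴ {x} {y} eq e with adj G (π₁ x) (π₁ y)
  ... | true = refl
  ... | false with π₁ x ≟ π₁ y
  ...   | yes _ = e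
  ...   | no neq = contradiction eq neq

  lex-adj⁻ : ∀ {x y} → adj Γ x y ≡ true →
             adj G (π₁ x) (π₁ y) ≡ true ⊎ (π₁ x ≡ π₁ y × adj H (π₂ x) (π₂ y) ≡ true)
  lex-adj⁻ {x} {y} e with adj G (π₁ x) (π₁ y)
  ... | true = inj₁ refl
  ... | false with π₁ x ≟ π₁ y
  ...   | yes eq = inj₂ (eq , e)
  lex-adj⁻ () | false | no _

  project-Walk : ∀ {j x y} → Walk Γ j x y → DistLe G j (π₁ x) (π₁ y)
  project-Walk here = DistLe-refl _
  project-Walk {x = x} (step {w = w} e rest) with project-Walk rest | lex-adj⁻ {x} {w} e
  ... | j , j≤ , walk | inj₁ eᴳ = suc j , s≤s j≤ , step eᴳ walk
  ... | j , j≤ , walk | inj₂ (eq , _) = j , ≤-trans j≤ (n≤1+n _) , subst (λ g → Walk G j g _) (sym eq) walk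

  project-DistLe : ∀ {k x y} → DistLe Γ k x y → DistLe G k (π₁ x) (π₁ y)
  project-DistLe (j , j≤k , walk) = DistLe-mono j≤k (project-Walk walk)

  lift-Walk : ∀ {j x y} → Walk G (suc j) (π₁ x) (π₁ y) → Walk Γ (suc j) x y
  lift-Walk (step e here) = step (lex-adjᴳ e) here
  lift-Walk {x = x} (step {w = g} e walk@(step _ _)) =
    step (lex-adjᴳ (subst (λ g′ → adj G (π₁ x) g′ ≡ true) π₁z≡g e))
         (lift-Walk (subst (λ g′ → Walk G _ g′ _) π₁z≡g walk))
    where
    π₁z≡g : g ≡ π₁ (combine g (π₂ x))
    π₁z≡g = sym (π₁-combine g (π₂ x))

  lift-DistLe : ∀ {k x y} → π₁ x ≢ π₁ y → DistLe G k (π₁ x) (π₁ y) → DistLe Γ k x y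
  lift-DistLe neq (zero , _ , walk) = contradiction (Walk-0⇒≡ walk) neq
  lift-DistLe neq (suc j , j≤k , walk) = suc j , j≤k , lift-Walk walk

  lift-DistLe-combine : ∀ {k g g′} h h′ → g ≢ g′ → DistLe G k g g′ →
                        DistLe Γ k (combine g h) (combine g′ h′)
  lift-DistLe-combine {k} {g} {g′} h h′ g≢g′ d =
    lift-DistLe (subst₂ _≢_ (sym eq) (sym eq′) g≢g′) (subst₂ (DistLe G k) (sym eq) (sym eq′) d)
    where
    eq = π₁-combine g h
    eq′ = π₁-combine g′ h′

  module _ (simpleᴳ : IsSimple G) (neighbourᴳ : ∀ g → ∃ λ g′ → adj G g g′ ≡ true) where

    same-fibre-DistLe : ∀ {x y} → π₁ x ≡ π₁ y → DistLe Γ 2 x y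
    same-fibre-DistLe {x} {y} eq = 2 , ≤-refl , step x∼z (step z∼y here)
      where
      g′ = proj₁ (neighbourᴳ (π₁ x))
      z = combine g′ (π₂ x)
      x∼z : adj Γ x z ≡ true
      x∼z = lex-adjᴳ (trans (cong (adj G (π₁ x)) (π₁-combine g′ (π₂ x))) (proj₂ (neighbourᴳ (π₁ x))))
      z∼y : adj Γ z y ≡ true
      z∼y = lex-adjᴳ (begin
        adj G (π₁ z) (π₁ y) ≡⟨ cong₂ (adj G) (π₁-combine g′ (π₂ x)) (sym eq) ⟩
        adj G g′ (π₁ x)     ≡⟨ proj₂ simpleᴳ g′ (π₁ x) ⟩
        adj G (π₁ x) g′     ≡⟨ proj₂ (neighbourᴳ (π₁ x)) ⟩
        true                ∎)
        where open ≡-Reasoning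

    lex-DistLe : ∀ {d} → 2 ≤ d → (∀ g g′ → DistLe G d g g′) → ∀ x y → DistLe Γ d x y
    lex-DistLe 2≤d diamᴳ x y with π₁ x ≟ π₁ y
    ... | yes eq = DistLe-mono 2≤d (same-fibre-DistLe eq)
    ... | no neq = lift-DistLe neq (diamᴳ (π₁ x) (π₁ y))

    Packing2-lex-≤ : ∀ {r} → IsRho2 G r → ∀ S → Packing2 Γ S → ∣ S ∣ ≤ r
    Packing2-lex-≤ {r} (_ , ρ₂-bound) S packing = begin
      ∣ S ∣             ≤⟨ ∣∣≤*∣shadow∣ S (λ g → ∣∣≤1 (fibre-singleton g)) ⟩
      1 * ∣ shadow S ∣  ≡⟨ *-identityˡ _ ⟩
      ∣ shadow S ∣      ≤⟨ ρ₂-bound (shadow S) shadow-packing ⟩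
      r                 ∎
      where
      open ≤-Reasoning
      fibre-singleton : ∀ g {h h′} → h ∈ fibre S g → h′ ∈ fibre S g → h ≡ h′
      fibre-singleton g {h} {h′} h∈ h′∈ = decidable-stable (h ≟ h′) λ h≢h′ →
        packing _ _ (∈-fibre⁻ h∈) (∈-fibre⁻ h′∈) (h≢h′ ∘ combine-injectiveʳ g h g h′)
          (same-fibre-DistLe (trans (π₁-combine g h) (sym (π₁-combine g h′))))
      shadow-packing : Packing2 G (shadow S)
      shadow-packing g g′ g∈ g′∈ g≢g′ d with ∈-shadow⁻ {S} g∈ | ∈-shadow⁻ {S} g′∈
      ... | h , x∈ | h′ , y∈ =
        packing _ _ x∈ y∈ (g≢g′ ∘ combine-injectiveˡ g h g′ h′) (lift-DistLe-combine h h′ g≢g′ d)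

  Independent-lex-≤ : ∀ {a b} → IsIndepNumber G a → IsIndepNumber H b →
                      ∀ S → Independent Γ S → ∣ S ∣ ≤ a * b
  Independent-lex-≤ {a} {b} (_ , αᴳ-bound) (_ , αᴴ-bound) S indep = begin
    ∣ S ∣            ≤⟨ ∣∣≤*∣shadow∣ S (λ g → αᴴ-bound (fibre S g) (fibre-independent g)) ⟩
    b * ∣ shadow S ∣ ≤⟨ *-monoʳ-≤ b (αᴳ-bound (shadow S) shadow-independent) ⟩
    b * a            ≡⟨ *-comm b a ⟩
    a * b            ∎
    where
    open ≤-Reasoning
    fibre-independent : ∀ g → Independent H (fibre S g)
    fibre-independent g h h′ h∈ h′∈ h≢h′ = ¬-not λ e →
      not-¬ (indep _ _ (∈-fibre⁻ h∈) (∈-fibre⁻ h′∈) (h≢h′ ∘ combine-injectiveʳ g h g h′))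
        (lex-adjᴴ (trans (π₁-combine g h) (sym (π₁-combine g h′)))
                  (subst₂ (λ u v → adj H u v ≡ true) (sym (π₂-combine g h)) (sym (π₂-combine g h′)) e))
    shadow-independent : Independent G (shadow S)
    shadow-independent g g′ g∈ g′∈ g≢g′ with ∈-shadow⁻ {S} g∈ | ∈-shadow⁻ {S} g′∈
    ... | h , x∈ | h′ , y∈ = ¬-not λ e →
      not-¬ (indep _ _ x∈ y∈ (g≢g′ ∘ combine-injectiveˡ g h g′ h′))
        (lex-adjᴳ (subst₂ (λ u v → adj G u v ≡ true) (sym (π₁-combine g h)) (sym (π₁-combine g′ h′)) e))

  Independent-⊗ : Loopless G → ∀ {A B} → Independent G A → Independent H B → Independent Γ (A ⊗ B)
  Independent-⊗ looplessᴳ {A} {B} indepᴬ indepᴮ x y x∈ y∈ x≢y = ¬-not (λ e → [ notᴳ , notᴴ ] (lex-adj⁻ e))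
    where
    x∈′ = ∈-⊗⁻ {A} {B} x∈
    y∈′ = ∈-⊗⁻ {A} {B} y∈
    notᴳ : adj G (π₁ x) (π₁ y) ≢ true
    notᴳ with π₁ x ≟ π₁ y
    ... | yes eq = not-¬ (trans (cong (adj G (π₁ x)) (sym eq)) (looplessᴳ (π₁ x)))
    ... | no neq = not-¬ (indepᴬ _ _ (proj₁ x∈′) (proj₁ y∈′) neq)
    notᴴ : ¬ (π₁ x ≡ π₁ y × adj H (π₂ x) (π₂ y) ≡ true)
    notᴴ (eq , eᴴ) = not-¬ (indepᴮ _ _ (proj₂ x∈′) (proj₂ y∈′) (x≢y ∘ π-injective eq)) eᴴ

  Packing2-⊗⁅⁆ : ∀ {S h} → Packing2 G S → Packing2 Γ (S ⊗ ⁅ h ⁆)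
  Packing2-⊗⁅⁆ {S} {h} packing x y x∈ y∈ x≢y d =
    packing _ _ (proj₁ x∈′) (proj₁ y∈′) (x≢y ∘ same-π₂) (project-DistLe d)
    where
    x∈′ = ∈-⊗⁻ {S} x∈
    y∈′ = ∈-⊗⁻ {S} y∈
    same-π₂ : π₁ x ≡ π₁ y → x ≡ y
    same-π₂ eq = π-injective eq (trans (x∈⁅y⁆⇒x≡y h (proj₂ x∈′)) (sym (x∈⁅y⁆⇒x≡y h (proj₂ y∈′))))

  lex-loopless : Loopless G → Loopless H → Loopless Γ
  lex-loopless looplessᴳ looplessᴴ x
    rewrite looplessᴳ (π₁ x) | dec-true (π₁ x ≟ π₁ x) refl | looplessᴴ (π₂ x) = refl

  lex-edge : HasEdge H → Fin (size G) → HasEdge Γ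
  lex-edge (h , h′ , e) g =
    combine g h , combine g h′ ,
    lex-adjᴴ (trans (π₁-combine g h) (sym (π₁-combine g h′)))
             (subst₂ (λ u v → adj H u v ≡ true) (sym (π₂-combine g h)) (sym (π₂-combine g h′)) e)

corollary2p5 : (G H : Graph) → IsSimple G → IsSimple H → Diam3 G → HasEdge H →
    (a b r k : ℕ) → IsIndepNumber G a → IsIndepNumber H b → IsRho2 G r →
    IsPackingChromaticNumber (lex G H) k →
    k + a * b + r ≡ size G * size H + 2
corollary2p5 G H simpleᴳ@(looplessᴳ , _) (looplessᴴ , _) diam3@(diamᴳ , g₀ , _) edgeᴴ a b r k
             αᴳ@((I , I-indep , ∣I∣≡a) , _) αᴴ@((J , J-indep , ∣J∣≡b) , _) ρᴳ@((P , P-packing , ∣P∣≡r) , _)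
             ((c , packing) , minimal) =
  ≤-antisym upper lower
  where
  open Lex G H
  neighbourᴳ = diam3⇒neighbour diam3

  lower : size G * size H + 2 ≤ k + a * b + r
  lower = packingColouring-lowerBound (lex-loopless looplessᴳ looplessᴴ) (lex-edge edgeᴴ g₀)
    (Independent-lex-≤ αᴳ αᴴ) (Packing2-lex-≤ simpleᴳ neighbourᴳ ρᴳ)
    (lex-DistLe simpleᴳ neighbourᴳ (s≤s (s≤s z≤n)) diamᴳ) packing

  upper : k + a * b + r ≤ size G * size H + 2
  upper with independent-omits looplessᴴ edgeᴴ J-indep
  ... | h₀ , h₀∉J = subst₂ (λ s t → k + s + t ≤ size G * size H + 2)
    (trans (∣⊗∣ I J) (cong₂ _*_ ∣I∣≡a ∣J∣≡b))
    (trans (∣⊗∣ P ⁅ h₀ ⁆) (trans (cong₂ _*_ ∣P∣≡r (∣⁅x⁆∣≡1 h₀)) (*-identityʳ r)))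
    (packingColouring-upperBound minimal
      (Independent-⊗ looplessᴳ I-indep J-indep) (Packing2-⊗⁅⁆ P-packing) (⊗⁅⁆-disjoint {I} h₀∉J))
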